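{- Define integers $\overline{u2}(n)$, $n\in\mathbb{N}_0$, by $\sum_{n\ge0}\overline{u2}(n)q^n:=\sum_{n\ge1}\frac{(-q^2;q^2)_{n-1}^2q^{2n}}{(q;-q)_{2n}}$. Then for all $n\in\mathbb{N}_0$, $\overline{u2}(n+1)\ge\overline{u2}(n)$.
   Context: For $n\in\mathbb{N}_0\cup\{\infty\}$, $(a;q)_n:=\prod_{j=0}^{n-1}(1-aq^j)$. -}

module Defs where

open import Data.Nat using (ℕ; zero; suc; _∸_; _≡ᵇ_)
open import Data.Integer using (ℤ; _+_; _*_; -_; 0ℤ; 1ℤ)
open import Data.List using (List; []; _∷_; _++_; foldr; map; upTo)
open import Data.Bool using (if_then_else_)

Series : Set
Series = ℕ → ℤ

sumBelow : ℕ → (ℕ → ℤ) → ℤ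
sumBelow n f = foldr _+_ 0ℤ (map f (upTo n))

sumFromTo : ℕ → ℕ → (ℕ → ℤ) → ℤ
sumFromTo a b f = sumBelow (suc b ∸ a) (λ k → f (a Data.Nat.+ k))

oneS : Series
oneS zero = 1ℤ
oneS (suc _) = 0ℤ

qS : Series
qS n = if n ≡ᵇ 1 then 1ℤ else 0ℤ

negS : Series → Series
negS f n = - f n

subS : Series → Series → Series
subS f g n = f n + - g n

mulS : Series → Series → Series
mulS f g n = sumBelow (suc n) (λ k → f k * g (n ∸ k))

powS : Series → ℕ → Series
powS f zero = oneS
powS f (suc k) = mulS (powS f k) f

qPoch : Series → Series → ℕ → Series
qPoch a q zero = oneS
qPoch a q (suc n) = mulS (qPoch a q n) (subS oneS (mulS a (powS q n)))

at : List ℤ → ℕ → ℤ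
at [] _ = 0ℤ
at (x ∷ xs) zero = x
at (x ∷ xs) (suc n) = at xs n

-- first n+1 coefficients of 1/f, for a series f with constant term 1:
-- g_0 = 1, g_m = - Σ_{k=1}^{m} f_k g_{m-k}
invList : Series → ℕ → List ℤ
invList f zero = 1ℤ ∷ []
invList f (suc n) =
  let l = invList f n in
  l ++ (- sumFromTo 1 (suc n) (λ k → f k * at l (suc n ∸ k)) ∷ [])

invS : Series → Series
invS f n = at (invList f n) n

summand : ℕ → Series
summand n =
  mulS (mulS (powS (qPoch (negS (powS qS 2)) (powS qS 2) (n ∸ 1)) 2)
             (powS qS (2 Data.Nat.* n)))
       (invS (qPoch qS (negS qS) (2 Data.Nat.* n)))

-- u2bar N = coefficient of q^N in Σ_{n≥1} summand n.
-- Summand n is divisible by q^{2n}, so only n ≤ N contribute to q^N;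
-- the sum over 1 ≤ n ≤ N is therefore the exact coefficient.
u2bar : ℕ → ℤ
u2bar N = sumFromTo 1 N (λ n → summand n N)

{-# OPTIONS --safe #-}
module Submission where

-- Multiplying the generating function by 1 - q gives the generating function of the differences
-- u2bar (N + 1) - u2bar N.  Since (q;-q)_{2n} = (q;q²)_n (-q²;q²)_n, the summand with n = m + 1 becomes
--   T_m = (-q²;q²)_m q^(2m+2) (1 - q^(2m+2)) / ((1 - q^(4m+4)) (q³;q²)_m).
-- For m ≥ 3 write 1 - q^(2m+2) = 1 - q³ q^(2m-1): as (1 - ab)/((1 - a)(1 - b)) = 1/(1 - b) + a/(1 - a)
-- and (q³;q²)_m contains the distinct factors 1 - q³ and 1 - q^(2m-1), T_m has nonnegative coefficients.
-- The terms T_0, …, T_3 are treated together: over the denominator 1 - q²⁴ their sum is a polynomial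
-- with nonnegative coefficients plus a series with nonnegative coefficients.

open import Defs
open import Algebra.Bundles using (CommutativeRing)
import Algebra.Solver.Ring
open import Algebra.Solver.Ring.AlmostCommutativeRing using (fromCommutativeRing; _-Raw-AlmostCommutative⟶_)
open import Algebra.Structures using (IsCommutativeRing)
open import Data.Integer as ℤ using (ℤ; 0ℤ; 1ℤ; +_; _≤_)
import Data.Integer.Properties as ℤP
open import Data.Integer.Solver using (module +-*-Solver)
open import Data.Fin using (zero)
open import Data.List using (List; []; _∷_; _++_; length; map; foldr; applyUpTo)
import Data.List.Properties as List
open import Data.Maybe using (Maybe; just; nothing; from-just)
import Data.Maybe as Maybe
open import Data.Nat as ℕ using (ℕ; zero; suc; _∸_; _<_; z≤n; s≤s)
open import Data.Nat.DivMod using (_%_; [m+n]%n≡m%n; m<n⇒m%n≡m)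
import Data.Nat.Properties as ℕ
open import Data.Product using (_×_; _,_; proj₁; proj₂; ∃-syntax)
open import Data.Sum using (inj₁; inj₂)
open import Data.Vec using ([]; _∷_)
open import Function using (_∘_; id)
open import Level using (0ℓ)
open import Relation.Binary.PropositionalEquality
  using (_≡_; refl; sym; trans; cong; cong₂; subst; module ≡-Reasoning)
import Relation.Binary.Reasoning.Setoid
open import Relation.Binary.Structures using (IsEquivalence)
open import Relation.Nullary using (yes; no)

∑ : ℕ → (ℕ → ℤ) → ℤ
∑ zero    f = 0ℤ
∑ (suc n) f = f 0 ℤ.+ ∑ n (f ∘ suc)

foldr-map-applyUpTo : ∀ n (f : ℕ → ℤ) g → foldr ℤ._+_ 0ℤ (map f (applyUpTo g n)) ≡ ∑ n (f ∘ g)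
foldr-map-applyUpTo zero    f g = refl
foldr-map-applyUpTo (suc n) f g = cong (ℤ._+_ (f (g 0))) (foldr-map-applyUpTo n f (g ∘ suc))

sumBelow≡∑ : ∀ n f → sumBelow n f ≡ ∑ n f
sumBelow≡∑ n f = foldr-map-applyUpTo n f id

∑-cong< : ∀ n {f g : ℕ → ℤ} → (∀ k → k < n → f k ≡ g k) → ∑ n f ≡ ∑ n g
∑-cong< zero    f≡g = refl
∑-cong< (suc n) f≡g = cong₂ ℤ._+_ (f≡g 0 (s≤s z≤n)) (∑-cong< n (λ k k<n → f≡g (suc k) (s≤s k<n)))

∑-cong : ∀ n {f g : ℕ → ℤ} → (∀ k → f k ≡ g k) → ∑ n f ≡ ∑ n g
∑-cong n f≡g = ∑-cong< n (λ k _ → f≡g k)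

∑-distrib-+ : ∀ n (f g : ℕ → ℤ) → ∑ n (λ k → f k ℤ.+ g k) ≡ ∑ n f ℤ.+ ∑ n g
∑-distrib-+ zero    f g = refl
∑-distrib-+ (suc n) f g = begin
  (f 0 ℤ.+ g 0) ℤ.+ ∑ n (λ k → f (suc k) ℤ.+ g (suc k))
    ≡⟨ cong (ℤ._+_ (f 0 ℤ.+ g 0)) (∑-distrib-+ n (f ∘ suc) (g ∘ suc)) ⟩
  (f 0 ℤ.+ g 0) ℤ.+ (∑ n (f ∘ suc) ℤ.+ ∑ n (g ∘ suc))
    ≡⟨ solve 4 (λ a b c d → (a :+ b) :+ (c :+ d) := (a :+ c) :+ (b :+ d)) refl
         (f 0) (g 0) (∑ n (f ∘ suc)) (∑ n (g ∘ suc)) ⟩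
  (f 0 ℤ.+ ∑ n (f ∘ suc)) ℤ.+ (g 0 ℤ.+ ∑ n (g ∘ suc)) ∎
  where open ≡-Reasoning; open +-*-Solver

∑-distribˡ-* : ∀ n c (f : ℕ → ℤ) → ∑ n (λ k → c ℤ.* f k) ≡ c ℤ.* ∑ n f
∑-distribˡ-* zero    c f = sym (ℤP.*-zeroʳ c)
∑-distribˡ-* (suc n) c f =
  trans (cong (ℤ._+_ (c ℤ.* f 0)) (∑-distribˡ-* n c (f ∘ suc))) (sym (ℤP.*-distribˡ-+ c (f 0) _))

∑-zero : ∀ n (f : ℕ → ℤ) → (∀ k → f k ≡ 0ℤ) → ∑ n f ≡ 0ℤ
∑-zero zero    f f≡0 = refl
∑-zero (suc n) f f≡0 = cong₂ ℤ._+_ (f≡0 0) (∑-zero n (f ∘ suc) (f≡0 ∘ suc))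

∑-snoc : ∀ n (f : ℕ → ℤ) → ∑ (suc n) f ≡ ∑ n f ℤ.+ f n
∑-snoc zero    f = trans (ℤP.+-identityʳ (f 0)) (sym (ℤP.+-identityˡ (f 0)))
∑-snoc (suc n) f = trans (cong (ℤ._+_ (f 0)) (∑-snoc n (f ∘ suc))) (sym (ℤP.+-assoc (f 0) _ _))

∑-reverse : ∀ n (f : ℕ → ℤ) → ∑ (suc n) f ≡ ∑ (suc n) (λ k → f (n ∸ k))
∑-reverse zero    f = refl
∑-reverse (suc n) f = begin
  f 0 ℤ.+ ∑ (suc n) (f ∘ suc)                ≡⟨ cong (ℤ._+_ (f 0)) (∑-reverse n (f ∘ suc)) ⟩
  f 0 ℤ.+ ∑ (suc n) (λ k → f (suc (n ∸ k)))  ≡⟨ ℤP.+-comm (f 0) _ ⟩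
  ∑ (suc n) (λ k → f (suc (n ∸ k))) ℤ.+ f 0
    ≡⟨ cong₂ ℤ._+_ (∑-cong< (suc n) (λ k k≤n → cong f (sym (ℕ.+-∸-assoc 1 (ℕ.<⇒≤pred k≤n)))))
                   (cong f (sym (ℕ.n∸n≡0 n))) ⟩
  ∑ (suc n) (λ k → f (suc n ∸ k)) ℤ.+ f (suc n ∸ suc n)
    ≡⟨ sym (∑-snoc (suc n) (λ k → f (suc n ∸ k))) ⟩
  ∑ (suc (suc n)) (λ k → f (suc n ∸ k)) ∎
  where open ≡-Reasoning

infix 4 _≈_
record _≈_ (f g : Series) : Set where
  constructor coeffwise
  field coeff : ∀ n → f n ≡ g n
open _≈_ public

constS : ℤ → Series
constS c zero    = c
constS c (suc _) = 0ℤ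

zeroS : Series
zeroS _ = 0ℤ

addS : Series → Series → Series
addS f g n = f n ℤ.+ g n

scaleS : ℤ → Series → Series
scaleS c f n = c ℤ.* f n

tailS : Series → Series
tailS f n = f (suc n)

mulS-∑ : ∀ f g n → mulS f g n ≡ ∑ (suc n) (λ k → f k ℤ.* g (n ∸ k))
mulS-∑ f g n = sumBelow≡∑ (suc n) (λ k → f k ℤ.* g (n ∸ k))

mulS-zero : ∀ f g → mulS f g 0 ≡ f 0 ℤ.* g 0 ℤ.+ 0ℤ
mulS-zero f g = mulS-∑ f g 0

mulS-suc : ∀ f g n → mulS f g (suc n) ≡ f 0 ℤ.* g (suc n) ℤ.+ mulS (tailS f) g n
mulS-suc f g n = trans (mulS-∑ f g (suc n)) (cong (ℤ._+_ (f 0 ℤ.* g (suc n))) (sym (mulS-∑ (tailS f) g n)))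

mulS-cong : ∀ {f f′ g g′} → f ≈ f′ → g ≈ g′ → mulS f g ≈ mulS f′ g′
mulS-cong {f} {f′} {g} {g′} f≈f′ g≈g′ = coeffwise λ n → begin
  mulS f g n                              ≡⟨ mulS-∑ f g n ⟩
  ∑ (suc n) (λ k → f k ℤ.* g (n ∸ k))
    ≡⟨ ∑-cong (suc n) (λ k → cong₂ ℤ._*_ (coeff f≈f′ k) (coeff g≈g′ (n ∸ k))) ⟩
  ∑ (suc n) (λ k → f′ k ℤ.* g′ (n ∸ k))   ≡⟨ mulS-∑ f′ g′ n ⟨
  mulS f′ g′ n                            ∎
  where open ≡-Reasoning

mulS-comm : ∀ f g → mulS f g ≈ mulS g f
mulS-comm f g = coeffwise λ n → begin
  mulS f g n                                ≡⟨ mulS-∑ f g n ⟩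
  ∑ (suc n) (λ k → f k ℤ.* g (n ∸ k))       ≡⟨ ∑-reverse n (λ k → f k ℤ.* g (n ∸ k)) ⟩
  ∑ (suc n) (λ k → f (n ∸ k) ℤ.* g (n ∸ (n ∸ k)))
    ≡⟨ ∑-cong< (suc n) {λ k → f (n ∸ k) ℤ.* g (n ∸ (n ∸ k))} {λ k → g k ℤ.* f (n ∸ k)}
         (λ k k<1+n → trans (ℤP.*-comm (f (n ∸ k)) (g (n ∸ (n ∸ k))))
                            (cong (λ i → g i ℤ.* f (n ∸ k)) (ℕ.m∸[m∸n]≡n (ℕ.<⇒≤pred k<1+n)))) ⟩
  ∑ (suc n) (λ k → g k ℤ.* f (n ∸ k))       ≡⟨ mulS-∑ g f n ⟨
  mulS g f n                                ∎
  where open ≡-Reasoning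

mulS-distribʳ : ∀ h f g → mulS (addS f g) h ≈ addS (mulS f h) (mulS g h)
mulS-distribʳ h f g = coeffwise λ n → begin
  mulS (addS f g) h n                                         ≡⟨ mulS-∑ (addS f g) h n ⟩
  ∑ (suc n) (λ k → (f k ℤ.+ g k) ℤ.* h (n ∸ k))
    ≡⟨ ∑-cong (suc n) (λ k → ℤP.*-distribʳ-+ (h (n ∸ k)) (f k) (g k)) ⟩
  ∑ (suc n) (λ k → f k ℤ.* h (n ∸ k) ℤ.+ g k ℤ.* h (n ∸ k))
    ≡⟨ ∑-distrib-+ (suc n) (λ k → f k ℤ.* h (n ∸ k)) (λ k → g k ℤ.* h (n ∸ k)) ⟩
  ∑ (suc n) (λ k → f k ℤ.* h (n ∸ k)) ℤ.+ ∑ (suc n) (λ k → g k ℤ.* h (n ∸ k))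
    ≡⟨ cong₂ ℤ._+_ (mulS-∑ f h n) (mulS-∑ g h n) ⟨
  mulS f h n ℤ.+ mulS g h n                                   ∎
  where open ≡-Reasoning

mulS-scaleS : ∀ c f g → mulS (scaleS c f) g ≈ scaleS c (mulS f g)
mulS-scaleS c f g = coeffwise λ n → begin
  mulS (scaleS c f) g n                            ≡⟨ mulS-∑ (scaleS c f) g n ⟩
  ∑ (suc n) (λ k → (c ℤ.* f k) ℤ.* g (n ∸ k))
    ≡⟨ ∑-cong (suc n) (λ k → ℤP.*-assoc c (f k) (g (n ∸ k))) ⟩
  ∑ (suc n) (λ k → c ℤ.* (f k ℤ.* g (n ∸ k)))
    ≡⟨ ∑-distribˡ-* (suc n) c (λ k → f k ℤ.* g (n ∸ k)) ⟩
  c ℤ.* ∑ (suc n) (λ k → f k ℤ.* g (n ∸ k))        ≡⟨ cong (c ℤ.*_) (mulS-∑ f g n) ⟨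
  c ℤ.* mulS f g n                                 ∎
  where open ≡-Reasoning

mulS-zeroˡ : ∀ f → mulS zeroS f ≈ zeroS
mulS-zeroˡ f = coeffwise λ n →
  trans (mulS-∑ zeroS f n) (∑-zero (suc n) _ (λ k → ℤP.*-zeroˡ (f (n ∸ k))))

mulS-constS : ∀ c f → mulS (constS c) f ≈ scaleS c f
mulS-constS c f = coeffwise λ
  { zero    → trans (mulS-zero (constS c) f) (ℤP.+-identityʳ _)
  ; (suc n) → trans (mulS-suc (constS c) f n)
                    (trans (cong (ℤ._+_ (c ℤ.* f (suc n))) (coeff (mulS-zeroˡ f) n)) (ℤP.+-identityʳ _))
  }

mulS-identityˡ : ∀ f → mulS (constS 1ℤ) f ≈ f
mulS-identityˡ f = coeffwise λ n → trans (coeff (mulS-constS 1ℤ f) n) (ℤP.*-identityˡ (f n))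

tailS-mulS : ∀ f g → tailS (mulS f g) ≈ addS (scaleS (f 0) (tailS g)) (mulS (tailS f) g)
tailS-mulS f g = coeffwise (mulS-suc f g)

mulS-assoc : ∀ f g h → mulS (mulS f g) h ≈ mulS f (mulS g h)
mulS-assoc f g h = coeffwise (assoc f g h)
  where
  open ≡-Reasoning
  open +-*-Solver
  assoc : ∀ f g h n → mulS (mulS f g) h n ≡ mulS f (mulS g h) n
  assoc f g h zero = begin
    mulS (mulS f g) h 0                        ≡⟨ mulS-zero (mulS f g) h ⟩
    mulS f g 0 ℤ.* h 0 ℤ.+ 0ℤ                  ≡⟨ cong (λ z → z ℤ.* h 0 ℤ.+ 0ℤ) (mulS-zero f g) ⟩
    (f 0 ℤ.* g 0 ℤ.+ 0ℤ) ℤ.* h 0 ℤ.+ 0ℤ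
      ≡⟨ solve 3 (λ a b c → (a :* b :+ con 0ℤ) :* c :+ con 0ℤ := a :* (b :* c :+ con 0ℤ) :+ con 0ℤ)
               refl (f 0) (g 0) (h 0) ⟩
    f 0 ℤ.* (g 0 ℤ.* h 0 ℤ.+ 0ℤ) ℤ.+ 0ℤ
      ≡⟨ cong (λ z → f 0 ℤ.* z ℤ.+ 0ℤ) (mulS-zero g h) ⟨
    f 0 ℤ.* mulS g h 0 ℤ.+ 0ℤ                  ≡⟨ mulS-zero f (mulS g h) ⟨
    mulS f (mulS g h) 0                        ∎
  assoc f g h (suc n) = begin
    mulS (mulS f g) h (suc n)                               ≡⟨ mulS-suc (mulS f g) h n ⟩
    mulS f g 0 ℤ.* h (suc n) ℤ.+ mulS (tailS (mulS f g)) h n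
      ≡⟨ cong₂ (λ a b → a ℤ.* h (suc n) ℤ.+ b) (mulS-zero f g)
               (coeff (mulS-cong (tailS-mulS f g) (coeffwise {h} {h} λ _ → refl)) n) ⟩
    (f 0 ℤ.* g 0 ℤ.+ 0ℤ) ℤ.* h (suc n) ℤ.+ mulS (addS (scaleS (f 0) (tailS g)) (mulS (tailS f) g)) h n
      ≡⟨ cong (ℤ._+_ ((f 0 ℤ.* g 0 ℤ.+ 0ℤ) ℤ.* h (suc n)))
              (trans (coeff (mulS-distribʳ h (scaleS (f 0) (tailS g)) (mulS (tailS f) g)) n)
                     (cong₂ ℤ._+_ (coeff (mulS-scaleS (f 0) (tailS g) h) n) (assoc (tailS f) g h n))) ⟩
    (f 0 ℤ.* g 0 ℤ.+ 0ℤ) ℤ.* h (suc n) ℤ.+ (f 0 ℤ.* mulS (tailS g) h n ℤ.+ mulS (tailS f) (mulS g h) n)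
      ≡⟨ solve 5 (λ a b c d e → (a :* b :+ con 0ℤ) :* c :+ (a :* d :+ e) := a :* (b :* c :+ d) :+ e) refl
               (f 0) (g 0) (h (suc n)) (mulS (tailS g) h n) (mulS (tailS f) (mulS g h) n) ⟩
    f 0 ℤ.* (g 0 ℤ.* h (suc n) ℤ.+ mulS (tailS g) h n) ℤ.+ mulS (tailS f) (mulS g h) n
      ≡⟨ cong (λ z → f 0 ℤ.* z ℤ.+ mulS (tailS f) (mulS g h) n) (mulS-suc g h n) ⟨
    f 0 ℤ.* mulS g h (suc n) ℤ.+ mulS (tailS f) (mulS g h) n ≡⟨ mulS-suc f (mulS g h) n ⟨
    mulS f (mulS g h) (suc n)                               ∎

≈-isEquivalence : IsEquivalence _≈_
≈-isEquivalence = record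
  { refl  = coeffwise λ _ → refl
  ; sym   = λ f≈g → coeffwise λ n → sym (coeff f≈g n)
  ; trans = λ f≈g g≈h → coeffwise λ n → trans (coeff f≈g n) (coeff g≈h n)
  }

-- The product is opaque so that the typechecker compares products of concrete series factor by factor
-- instead of expanding their coefficients.
opaque
  infixl 7 _⊛_
  _⊛_ : Series → Series → Series
  _⊛_ = mulS

opaque
  unfolding _⊛_

  ⊛-coeff : ∀ f g n → (f ⊛ g) n ≡ mulS f g n
  ⊛-coeff f g n = refl

  ⊛-isCommutativeRing : IsCommutativeRing _≈_ addS _⊛_ negS zeroS (constS 1ℤ)
  ⊛-isCommutativeRing = record
    { isRing = record
      { +-isAbelianGroup = record
        { isGroup = record
          { isMonoid = record
            { isSemigroup = record
              { isMagma = record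
                { isEquivalence = ≈-isEquivalence
                ; ∙-cong = λ f≈f′ g≈g′ → coeffwise λ n →
                             cong₂ ℤ._+_ (coeff f≈f′ n) (coeff g≈g′ n) }
              ; assoc = λ f g h → coeffwise λ n → ℤP.+-assoc (f n) (g n) (h n) }
            ; identity = (λ f → coeffwise λ n → ℤP.+-identityˡ (f n))
                       , (λ f → coeffwise λ n → ℤP.+-identityʳ (f n)) }
          ; inverse = (λ f → coeffwise λ n → ℤP.+-inverseˡ (f n))
                    , (λ f → coeffwise λ n → ℤP.+-inverseʳ (f n))
          ; ⁻¹-cong = λ f≈g → coeffwise λ n → cong ℤ.-_ (coeff f≈g n) }
        ; comm = λ f g → coeffwise λ n → ℤP.+-comm (f n) (g n) }
      ; *-cong = mulS-cong
      ; *-assoc = mulS-assoc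
      ; *-identity = mulS-identityˡ
                   , λ f → coeffwise λ n → trans (coeff (mulS-comm f (constS 1ℤ)) n) (coeff (mulS-identityˡ f) n)
      ; distrib = (λ h f g → coeffwise λ n → trans (coeff (mulS-comm h (addS f g)) n)
                     (trans (coeff (mulS-distribʳ h f g) n)
                            (cong₂ ℤ._+_ (coeff (mulS-comm f h) n) (coeff (mulS-comm g h) n))))
                , mulS-distribʳ }
    ; *-comm = mulS-comm }

ℤ⟦q⟧ : CommutativeRing 0ℓ 0ℓ
ℤ⟦q⟧ = record
  { Carrier = Series ; _≈_ = _≈_ ; _+_ = addS ; _*_ = _⊛_ ; -_ = negS ; 0# = zeroS ; 1# = constS 1ℤ
  ; isCommutativeRing = ⊛-isCommutativeRing }

⊛≈mulS : ∀ f g → f ⊛ g ≈ mulS f g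
⊛≈mulS f g = coeffwise (⊛-coeff f g)

constS-homomorphism :
  CommutativeRing.rawRing ℤP.+-*-commutativeRing -Raw-AlmostCommutative⟶ fromCommutativeRing ℤ⟦q⟧
constS-homomorphism = record
  { ⟦_⟧ = constS
  ; +-homo = λ a b → coeffwise λ { zero → refl ; (suc n) → refl }
  ; *-homo = λ a b → coeffwise λ
      { zero    → sym (trans (⊛-coeff (constS a) (constS b) 0) (coeff (mulS-constS a (constS b)) 0))
      ; (suc n) → sym (trans (⊛-coeff (constS a) (constS b) (suc n))
                             (trans (coeff (mulS-constS a (constS b)) (suc n)) (ℤP.*-zeroʳ a))) }
  ; -‿homo = λ a → coeffwise λ { zero → refl ; (suc n) → refl }
  ; 0-homo = coeffwise λ { zero → refl ; (suc n) → refl }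
  ; 1-homo = coeffwise λ { zero → refl ; (suc n) → refl } }

constS-≟ : ∀ a b → Maybe (constS a ≈ constS b)
constS-≟ a b with a ℤ.≟ b
... | yes refl = just (coeffwise λ _ → refl)
... | no _     = nothing

open Algebra.Solver.Ring (CommutativeRing.rawRing ℤP.+-*-commutativeRing) (fromCommutativeRing ℤ⟦q⟧)
  constS-homomorphism constS-≟
  using ( solve; _:=_; con; var; _:+_; _:*_; _:-_; :-_; _:^_
        ; Polynomial; normalise; _≟N_; ⟦_⟧; ⟦_⟧N; ⟦_⟧N-cong; correct)
open CommutativeRing ℤ⟦q⟧
  using ( _+_; _*_; -_; _-_; 1#; 0#; setoid; +-cong; +-congˡ; +-congʳ; *-cong; *-congˡ; *-congʳ; -‿cong
        ; +-assoc; +-identityˡ; +-identityʳ; *-assoc; *-comm; *-identityˡ; *-identityʳ; zeroʳ; distribˡ)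
  renaming (refl to ≈-refl; sym to ≈-sym; trans to ≈-trans)
open import Algebra.Properties.Semiring.Exp (CommutativeRing.semiring ℤ⟦q⟧)
  using (_^_; ^-homo-*; ^-cong; ^-assocʳ)
module ≈-Reasoning = Relation.Binary.Reasoning.Setoid setoid

infix 8 q^_
q^_ : ℕ → Series
q^ k = qS ^ k

q^-cong : ∀ {i j} → i ≡ j → q^ i ≈ q^ j
q^-cong refl = ≈-refl

mulS≈* : ∀ f g → mulS f g ≈ f * g
mulS≈* f g = ≈-sym (⊛≈mulS f g)

oneS≈1 : oneS ≈ 1#
oneS≈1 = coeffwise λ { zero → refl ; (suc n) → refl }

powS≈^ : ∀ f k → powS f k ≈ f ^ k
powS≈^ f zero    = oneS≈1
powS≈^ f (suc k) = ≈-trans (mulS≈* (powS f k) f) (≈-trans (*-comm (powS f k) f) (*-congˡ (powS≈^ f k)))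

-- Unlike solve, this decides an identity by comparing the normal forms' integer coefficients, which stays
-- cheap for polynomials of high degree.
identity? : ∀ {n} (p₁ p₂ : Polynomial n) → Maybe (∀ ρ → ⟦ p₁ ⟧ ρ ≈ ⟦ p₂ ⟧ ρ)
identity? p₁ p₂ = Maybe.map (λ p₁≈p₂ ρ → begin
  ⟦ p₁ ⟧ ρ              ≈⟨ correct p₁ ρ ⟨
  ⟦ normalise p₁ ⟧N ρ   ≈⟨ ⟦ p₁≈p₂ ⟧N-cong ρ ⟩
  ⟦ normalise p₂ ⟧N ρ   ≈⟨ correct p₂ ρ ⟩
  ⟦ p₂ ⟧ ρ              ∎) (normalise p₁ ≟N normalise p₂)
  where open ≈-Reasoning

X : Polynomial 1
X = var zero

⟦_⟧q : Polynomial 1 → Series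
⟦ p ⟧q = ⟦ p ⟧ (qS ∷ [])

q-identity? : (p₁ p₂ : Polynomial 1) → Maybe (⟦ p₁ ⟧q ≈ ⟦ p₂ ⟧q)
q-identity? p₁ p₂ = Maybe.map (λ p₁≈p₂ → p₁≈p₂ (qS ∷ [])) (identity? p₁ p₂)

horner : List ℕ → Polynomial 1
horner []       = con 0ℤ
horner (c ∷ cs) = con (+ c) :+ X :* horner cs

polynomial : List ℕ → Series
polynomial cs = ⟦ horner cs ⟧q

q*-coeff-zero : ∀ f → (qS * f) 0 ≡ 0ℤ
q*-coeff-zero f = trans (⊛-coeff qS f 0) (trans (mulS-zero qS f) (ℤP.*-zeroˡ (f 0)))

q*-coeff-suc : ∀ f n → (qS * f) (suc n) ≡ f n
q*-coeff-suc f n = begin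
  (qS * f) (suc n)                         ≡⟨ ⊛-coeff qS f (suc n) ⟩
  mulS qS f (suc n)                        ≡⟨ mulS-suc qS f n ⟩
  0ℤ ℤ.* f (suc n) ℤ.+ mulS (tailS qS) f n
    ≡⟨ cong₂ ℤ._+_ (ℤP.*-zeroˡ (f (suc n))) (coeff (mulS-cong tailS-qS (≈-refl {f})) n) ⟩
  0ℤ ℤ.+ mulS 1# f n                       ≡⟨ ℤP.+-identityˡ _ ⟩
  mulS 1# f n                              ≡⟨ coeff (mulS-identityˡ f) n ⟩
  f n                                      ∎
  where
  open ≡-Reasoning
  tailS-qS : tailS qS ≈ 1#
  tailS-qS = coeffwise λ { zero → refl ; (suc n) → refl }

q^*-coeff-+ : ∀ k f j → (q^ k * f) (k ℕ.+ j) ≡ f j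
q^*-coeff-+ zero    f j = coeff (*-identityˡ f) j
q^*-coeff-+ (suc k) f j =
  trans (coeff (*-assoc qS (q^ k) f) (suc k ℕ.+ j)) (trans (q*-coeff-suc (q^ k * f) (k ℕ.+ j)) (q^*-coeff-+ k f j))

q^*-coeff-< : ∀ k f j → j < k → (q^ k * f) j ≡ 0ℤ
q^*-coeff-< (suc k) f zero    _         = trans (coeff (*-assoc qS (q^ k) f) 0) (q*-coeff-zero (q^ k * f))
q^*-coeff-< (suc k) f (suc j) (s≤s j<k) =
  trans (coeff (*-assoc qS (q^ k) f) (suc j)) (trans (q*-coeff-suc (q^ k * f) j) (q^*-coeff-< k f j j<k))

[1-q]*-coeff-suc : ∀ f n → ((1# - qS) * f) (suc n) ≡ f (suc n) ℤ.- f n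
[1-q]*-coeff-suc f n = begin
  ((1# - qS) * f) (suc n)
    ≡⟨ coeff (solve 2 (λ q f → (con 1ℤ :- q) :* f := f :- q :* f) ≈-refl qS f) (suc n) ⟩
  f (suc n) ℤ.+ ℤ.- (qS * f) (suc n) ≡⟨ cong (λ c → f (suc n) ℤ.- c) (q*-coeff-suc f n) ⟩
  f (suc n) ℤ.- f n                  ∎
  where open ≡-Reasoning

∑S : ℕ → (ℕ → Series) → Series
∑S zero    f = 0#
∑S (suc M) f = ∑S M f + f M

∑S-coeff : ∀ M f n → ∑S M f n ≡ ∑ M (λ m → f m n)
∑S-coeff zero    f n = refl
∑S-coeff (suc M) f n = trans (cong (ℤ._+ f M n) (∑S-coeff M f n)) (sym (∑-snoc M (λ m → f m n)))

∑S-cong : ∀ M {f g} → (∀ m → f m ≈ g m) → ∑S M f ≈ ∑S M g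
∑S-cong zero    f≈g = ≈-refl
∑S-cong (suc M) f≈g = +-cong (∑S-cong M f≈g) (f≈g M)

*-distribˡ-∑S : ∀ a M f → a * ∑S M f ≈ ∑S M (λ m → a * f m)
*-distribˡ-∑S a zero    f = zeroʳ a
*-distribˡ-∑S a (suc M) f = ≈-trans (distribˡ a (∑S M f) (f M)) (+-congʳ (*-distribˡ-∑S a M f))

record Nonneg (f : Series) : Set where
  constructor nonneg
  field coeff-nonneg : ∀ n → 0ℤ ≤ f n
open Nonneg

nonneg-cong : ∀ {f g} → f ≈ g → Nonneg f → Nonneg g
nonneg-cong f≈g f≥0 = nonneg (λ n → subst (0ℤ ≤_) (coeff f≈g n) (coeff-nonneg f≥0 n))

nonneg-+ : ∀ {f g} → Nonneg f → Nonneg g → Nonneg (f + g)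
nonneg-+ f≥0 g≥0 = nonneg (λ n → ℤP.+-mono-≤ (coeff-nonneg f≥0 n) (coeff-nonneg g≥0 n))

∑-nonneg : ∀ n (f : ℕ → ℤ) → (∀ k → 0ℤ ≤ f k) → 0ℤ ≤ ∑ n f
∑-nonneg zero    f f≥0 = ℤP.≤-refl
∑-nonneg (suc n) f f≥0 = ℤP.+-mono-≤ (f≥0 0) (∑-nonneg n (f ∘ suc) (f≥0 ∘ suc))

*-nonneg : ∀ {i j} → 0ℤ ≤ i → 0ℤ ≤ j → 0ℤ ≤ i ℤ.* j
*-nonneg {+ m} {+ n} _ _ = subst (0ℤ ≤_) (ℤP.pos-* m n) (ℤ.+≤+ z≤n)

nonneg-* : ∀ {f g} → Nonneg f → Nonneg g → Nonneg (f * g)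
nonneg-* {f} {g} f≥0 g≥0 = nonneg λ n →
  subst (0ℤ ≤_) (sym (trans (⊛-coeff f g n) (mulS-∑ f g n)))
        (∑-nonneg (suc n) _ (λ k → *-nonneg (coeff-nonneg f≥0 k) (coeff-nonneg g≥0 (n ∸ k))))

nonneg-constS : ∀ c → Nonneg (constS (+ c))
nonneg-constS c = nonneg λ { zero → ℤ.+≤+ z≤n ; (suc n) → ℤ.+≤+ z≤n }

nonneg-q : Nonneg qS
nonneg-q = nonneg λ { 0 → ℤ.+≤+ z≤n ; 1 → ℤ.+≤+ z≤n ; (suc (suc n)) → ℤ.+≤+ z≤n }

nonneg-q^ : ∀ k → Nonneg (q^ k)
nonneg-q^ zero    = nonneg-constS 1
nonneg-q^ (suc k) = nonneg-* nonneg-q (nonneg-q^ k)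

nonneg-polynomial : ∀ cs → Nonneg (polynomial cs)
nonneg-polynomial []       = nonneg-constS 0
nonneg-polynomial (c ∷ cs) = nonneg-+ (nonneg-constS c) (nonneg-* nonneg-q (nonneg-polynomial cs))

at-++-< : ∀ (l : List ℤ) c j → j < length l → at (l ++ c ∷ []) j ≡ at l j
at-++-< (_ ∷ l) c zero    _         = refl
at-++-< (_ ∷ l) c (suc j) (s≤s j<l) = at-++-< l c j j<l

at-++-length : ∀ (l : List ℤ) c → at (l ++ c ∷ []) (length l) ≡ c
at-++-length []      c = refl
at-++-length (_ ∷ l) c = at-++-length l c

length-invList : ∀ f n → length (invList f n) ≡ suc n
length-invList f zero    = refl
length-invList f (suc n) =
  trans (List.length-++ (invList f n)) (trans (cong (ℕ._+ 1) (length-invList f n)) (ℕ.+-comm (suc n) 1))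

at-invList : ∀ f {n j} → j ℕ.≤ n → at (invList f n) j ≡ invS f j
at-invList f {zero}  z≤n = refl
at-invList f {suc n} j≤1+n with ℕ.m≤n⇒m<n∨m≡n j≤1+n
... | inj₂ refl      = refl
... | inj₁ (s≤s j≤n) =
  trans (at-++-< (invList f n) _ _ (subst (_ <_) (sym (length-invList f n)) (s≤s j≤n))) (at-invList f j≤n)

invS-suc : ∀ f n → invS f (suc n) ≡ ℤ.- ∑ (suc n) (λ k → f (suc k) ℤ.* invS f (n ∸ k))
invS-suc f n = begin
  at (invList f n ++ c ∷ []) (suc n)          ≡⟨ cong (at (invList f n ++ c ∷ [])) (length-invList f n) ⟨
  at (invList f n ++ c ∷ []) (length (invList f n)) ≡⟨ at-++-length (invList f n) c ⟩
  ℤ.- sumBelow (suc n) (λ k → f (suc k) ℤ.* at (invList f n) (n ∸ k))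
    ≡⟨ cong ℤ.-_ (sumBelow≡∑ (suc n) (λ k → f (suc k) ℤ.* at (invList f n) (n ∸ k))) ⟩
  ℤ.- ∑ (suc n) (λ k → f (suc k) ℤ.* at (invList f n) (n ∸ k))
    ≡⟨ cong ℤ.-_ (∑-cong (suc n) (λ k → cong (f (suc k) ℤ.*_) (at-invList f (ℕ.m∸n≤m n k)))) ⟩
  ℤ.- ∑ (suc n) (λ k → f (suc k) ℤ.* invS f (n ∸ k)) ∎
  where
  open ≡-Reasoning
  c = ℤ.- sumFromTo 1 (suc n) (λ k → f k ℤ.* at (invList f n) (suc n ∸ k))

*-invS : ∀ f → f 0 ≡ 1ℤ → f * invS f ≈ 1#
*-invS f f₀≡1 = coeffwise λ
  { zero    → trans (⊛-coeff f (invS f) 0)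
                    (trans (mulS-zero f (invS f)) (cong (λ c → c ℤ.* 1ℤ ℤ.+ 0ℤ) f₀≡1))
  ; (suc n) → coeff-suc n }
  where
  open ≡-Reasoning
  coeff-suc : ∀ n → (f * invS f) (suc n) ≡ 0ℤ
  coeff-suc n = begin
    (f * invS f) (suc n)                                  ≡⟨ ⊛-coeff f (invS f) (suc n) ⟩
    mulS f (invS f) (suc n)                               ≡⟨ mulS-suc f (invS f) n ⟩
    f 0 ℤ.* invS f (suc n) ℤ.+ mulS (tailS f) (invS f) n
      ≡⟨ cong₂ ℤ._+_ (cong₂ ℤ._*_ f₀≡1 (invS-suc f n)) (mulS-∑ (tailS f) (invS f) n) ⟩
    1ℤ ℤ.* ℤ.- S ℤ.+ S                              ≡⟨ cong (ℤ._+ S) (ℤP.*-identityˡ (ℤ.- S)) ⟩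
    ℤ.- S ℤ.+ S                                           ≡⟨ ℤP.+-inverseˡ S ⟩
    0ℤ                                                    ∎
    where S = ∑ (suc n) (λ k → f (suc k) ℤ.* invS f (n ∸ k))

*-cancelʳ-invertible : ∀ {a b} d e → d * e ≈ 1# → a * d ≈ b * d → a ≈ b
*-cancelʳ-invertible {a} {b} d e de≈1 ad≈bd = begin
  a              ≈⟨ solve 1 (λ a → a := a :* con 1ℤ) ≈-refl a ⟩
  a * 1#         ≈⟨ *-congˡ de≈1 ⟨
  a * (d * e)    ≈⟨ *-assoc a d e ⟨
  (a * d) * e    ≈⟨ *-congʳ ad≈bd ⟩
  (b * d) * e    ≈⟨ *-assoc b d e ⟩
  b * (d * e)    ≈⟨ *-congˡ de≈1 ⟩
  b * 1#         ≈⟨ solve 1 (λ b → b :* con 1ℤ := b) ≈-refl b ⟩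
  b              ∎
  where open ≈-Reasoning

geom : (s : ℕ) → .{{ℕ.NonZero s}} → Series
geom s n = constS 1ℤ (n % s)

geom-unfold : ∀ s .{{_ : ℕ.NonZero s}} → geom s ≈ 1# + q^ s * geom s
geom-unfold s@(suc _) = coeffwise coeffs
  where
  open ≡-Reasoning
  coeffs : ∀ n → geom s n ≡ (1# + q^ s * geom s) n
  coeffs n with ℕ.<-≤-connex n s
  ... | inj₁ n<s = begin
    constS 1ℤ (n % s)                 ≡⟨ cong (constS 1ℤ) (m<n⇒m%n≡m n<s) ⟩
    constS 1ℤ n                       ≡⟨ ℤP.+-identityʳ _ ⟨
    constS 1ℤ n ℤ.+ 0ℤ                ≡⟨ cong (ℤ._+_ (constS 1ℤ n)) (q^*-coeff-< s (geom s) n n<s) ⟨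
    constS 1ℤ n ℤ.+ (q^ s * geom s) n ∎
  ... | inj₂ s≤n = subst (λ n → geom s n ≡ (1# + q^ s * geom s) n) (ℕ.m+[n∸m]≡n s≤n) (begin
    constS 1ℤ ((s ℕ.+ j) % s)                   ≡⟨ cong (λ i → constS 1ℤ (i % s)) (ℕ.+-comm s j) ⟩
    constS 1ℤ ((j ℕ.+ s) % s)                         ≡⟨ cong (constS 1ℤ) ([m+n]%n≡m%n j s) ⟩
    geom s j                                          ≡⟨ q^*-coeff-+ s (geom s) j ⟨
    (q^ s * geom s) (s ℕ.+ j)                         ≡⟨ ℤP.+-identityˡ _ ⟨
    constS 1ℤ (s ℕ.+ j) ℤ.+ (q^ s * geom s) (s ℕ.+ j) ∎)
    where j = n ∸ s

geom-inverse : ∀ s .{{_ : ℕ.NonZero s}} → geom s * (1# - q^ s) ≈ 1#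
geom-inverse s = begin
  geom s * (1# - q^ s)
    ≈⟨ solve 2 (λ g e → g :* (con 1ℤ :- e) := g :- e :* g) ≈-refl (geom s) (q^ s) ⟩
  geom s - q^ s * geom s
    ≈⟨ +-congʳ (geom-unfold s) ⟩
  (1# + q^ s * geom s) - q^ s * geom s
    ≈⟨ solve 2 (λ a b → (a :+ b) :- b := a) ≈-refl 1# (q^ s * geom s) ⟩
  1# ∎
  where open ≈-Reasoning

*-cancelʳ-[1-q^] : ∀ s .{{_ : ℕ.NonZero s}} {f g} → f * (1# - q^ s) ≈ g * (1# - q^ s) → f ≈ g
*-cancelʳ-[1-q^] s =
  *-cancelʳ-invertible (1# - q^ s) (geom s) (≈-trans (*-comm (1# - q^ s) (geom s)) (geom-inverse s))

nonneg-geom : ∀ s .{{_ : ℕ.NonZero s}} → Nonneg (geom s)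
nonneg-geom s = nonneg λ n → coeff-nonneg (nonneg-constS 1) (n % s)

[1-q^a+b]*geom*geom : ∀ a b .{{_ : ℕ.NonZero a}} .{{_ : ℕ.NonZero b}} →
  (1# - q^ (a ℕ.+ b)) * geom a * geom b ≈ geom b + q^ a * geom a
[1-q^a+b]*geom*geom a b = begin
  (1# - q^ (a ℕ.+ b)) * ga * gb
    ≈⟨ *-congʳ {gb} (*-congʳ {ga} (+-congˡ {1#} (-‿cong (^-homo-* qS a b)))) ⟩
  (1# - q^ a * q^ b) * ga * gb
    ≈⟨ solve 4 (λ ea eb ga gb → (con 1ℤ :- ea :* eb) :* ga :* gb
                  := gb :* (ga :* (con 1ℤ :- ea)) :+ ea :* ga :* (gb :* (con 1ℤ :- eb)))
               ≈-refl (q^ a) (q^ b) ga gb ⟩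
  gb * (ga * (1# - q^ a)) + q^ a * ga * (gb * (1# - q^ b))
    ≈⟨ +-cong (*-congˡ (geom-inverse a)) (*-congˡ (geom-inverse b)) ⟩
  gb * 1# + q^ a * ga * 1#
    ≈⟨ solve 2 (λ u v → u :* con 1ℤ :+ v :* con 1ℤ := u :+ v) ≈-refl gb (q^ a * ga) ⟩
  gb + q^ a * ga ∎
  where
  open ≈-Reasoning
  ga = geom a
  gb = geom b

geom≈*geom : ∀ a b .{{_ : ℕ.NonZero a}} .{{_ : ℕ.NonZero b}} c →
  1# - q^ b ≈ (1# - q^ a) * c → geom a ≈ c * geom b
geom≈*geom a b c 1-q^b≈ = *-cancelʳ-[1-q^] a (begin
  geom a * (1# - q^ a)         ≈⟨ geom-inverse a ⟩
  1#                           ≈⟨ geom-inverse b ⟨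
  geom b * (1# - q^ b)         ≈⟨ *-congˡ 1-q^b≈ ⟩
  geom b * ((1# - q^ a) * c)
    ≈⟨ solve 3 (λ g d c → g :* (d :* c) := c :* g :* d) ≈-refl (geom b) (1# - q^ a) c ⟩
  c * geom b * (1# - q^ a)     ∎)
  where open ≈-Reasoning

geom≈+q^*geom : ∀ a b .{{_ : ℕ.NonZero a}} c → c * (1# - q^ a) ≈ 1# - q^ b → geom a ≈ c + q^ b * geom a
geom≈+q^*geom a b c c*[1-q^a]≈ = *-cancelʳ-[1-q^] a (begin
  geom a * (1# - q^ a)                             ≈⟨ geom-inverse a ⟩
  1#                                               ≈⟨ solve 1 (λ y → con 1ℤ := con 1ℤ :- y :+ y) ≈-refl (q^ b) ⟩
  1# - q^ b + q^ b
    ≈⟨ +-cong c*[1-q^a]≈ (≈-trans (*-congˡ (geom-inverse a)) (*-identityʳ (q^ b))) ⟨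
  c * (1# - q^ a) + q^ b * (geom a * (1# - q^ a))
    ≈⟨ solve 4 (λ c y g d → c :* d :+ y :* (g :* d) := (c :+ y :* g) :* d) ≈-refl
         c (q^ b) (geom a) (1# - q^ a) ⟩
  (c + q^ b * geom a) * (1# - q^ a)                ∎)
  where open ≈-Reasoning

[1-q^a]*geom*geom≈*geom : ∀ a b c d .{{_ : ℕ.NonZero b}} .{{_ : ℕ.NonZero c}} .{{_ : ℕ.NonZero d}} p →
  (1# - q^ a) * (1# - q^ d) ≈ (1# - q^ b) * (1# - q^ c) * p → (1# - q^ a) * geom b * geom c ≈ p * geom d
[1-q^a]*geom*geom≈*geom a b c d p identity = *-cancelʳ-[1-q^] d (begin
  (1# - q^ a) * geom b * geom c * (1# - q^ d)
    ≈⟨ solve 4 (λ a g h d → a :* g :* h :* d := g :* h :* (a :* d)) ≈-refl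
         (1# - q^ a) (geom b) (geom c) (1# - q^ d) ⟩
  geom b * geom c * ((1# - q^ a) * (1# - q^ d))
    ≈⟨ *-congˡ identity ⟩
  geom b * geom c * ((1# - q^ b) * (1# - q^ c) * p)
    ≈⟨ solve 5 (λ g h u v p → g :* h :* (u :* v :* p) := (g :* u) :* (h :* v) :* p) ≈-refl
         (geom b) (geom c) (1# - q^ b) (1# - q^ c) p ⟩
  (geom b * (1# - q^ b)) * (geom c * (1# - q^ c)) * p
    ≈⟨ *-congʳ (*-cong (geom-inverse b) (geom-inverse c)) ⟩
  1# * 1# * p
    ≈⟨ solve 1 (λ p → con 1ℤ :* con 1ℤ :* p := p :* con 1ℤ) ≈-refl p ⟩
  p * 1#
    ≈⟨ *-congˡ (geom-inverse d) ⟨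
  p * (geom d * (1# - q^ d))
    ≈⟨ *-assoc p (geom d) (1# - q^ d) ⟨
  p * geom d * (1# - q^ d) ∎)
  where open ≈-Reasoning

[1-q^e]*[1+q^e]*geom[e+e] : ∀ e .{{_ : ℕ.NonZero (e ℕ.+ e)}} →
  (1# - q^ e) * (1# + q^ e) * geom (e ℕ.+ e) ≈ 1#
[1-q^e]*[1+q^e]*geom[e+e] e = begin
  (1# - q^ e) * (1# + q^ e) * geom (e ℕ.+ e)
    ≈⟨ solve 2 (λ a g → (con 1ℤ :- a) :* (con 1ℤ :+ a) :* g := g :* (con 1ℤ :- a :* a)) ≈-refl
         (q^ e) (geom (e ℕ.+ e)) ⟩
  geom (e ℕ.+ e) * (1# - q^ e * q^ e)
    ≈⟨ *-congˡ {geom (e ℕ.+ e)} (+-congˡ {1#} (-‿cong (^-homo-* qS e e))) ⟨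
  geom (e ℕ.+ e) * (1# - q^ (e ℕ.+ e))
    ≈⟨ geom-inverse (e ℕ.+ e) ⟩
  1# ∎
  where open ≈-Reasoning

OnePlusNonneg : Series → Set
OnePlusNonneg f = ∃[ h ] Nonneg h × f ≈ 1# + h

onePlusNonneg-cong : ∀ {f g} → f ≈ g → OnePlusNonneg f → OnePlusNonneg g
onePlusNonneg-cong f≈g (h , h≥0 , f≈1+h) = h , h≥0 , ≈-trans (≈-sym f≈g) f≈1+h

onePlusNonneg-1# : OnePlusNonneg 1#
onePlusNonneg-1# = 0# , nonneg (λ _ → ℤ.+≤+ z≤n) , ≈-sym (+-identityʳ 1#)

onePlusNonneg-1+ : ∀ {h} → Nonneg h → OnePlusNonneg (1# + h)
onePlusNonneg-1+ h≥0 = _ , h≥0 , ≈-refl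

onePlusNonneg-* : ∀ {f g} → OnePlusNonneg f → OnePlusNonneg g → OnePlusNonneg (f * g)
onePlusNonneg-* (h , h≥0 , f≈1+h) (k , k≥0 , g≈1+k) =
  h + k + h * k , nonneg-+ (nonneg-+ h≥0 k≥0) (nonneg-* h≥0 k≥0) ,
  ≈-trans (*-cong f≈1+h g≈1+k)
    (solve 2 (λ h k → (con 1ℤ :+ h) :* (con 1ℤ :+ k) := con 1ℤ :+ (h :+ k :+ h :* k)) ≈-refl h k)

onePlusNonneg-geom : ∀ s .{{_ : ℕ.NonZero s}} → OnePlusNonneg (geom s)
onePlusNonneg-geom s =
  onePlusNonneg-cong (≈-sym (geom-unfold s)) (onePlusNonneg-1+ (nonneg-* (nonneg-q^ s) (nonneg-geom s)))

-- evenPoch m = (-q²;q²)_m,  oddPoch n = (q;q²)_n,  oddGeom m = 1/(q³;q²)_m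
evenPoch : ℕ → Series
evenPoch zero    = 1#
evenPoch (suc m) = evenPoch m * (1# + q^ (2 ℕ.* suc m))

oddPoch : ℕ → Series
oddPoch zero    = 1#
oddPoch (suc n) = oddPoch n * (1# - q^ (suc (2 ℕ.* n)))

oddGeom : ℕ → Series
oddGeom zero    = 1#
oddGeom (suc m) = oddGeom m * geom (suc (2 ℕ.* suc m))

oddGeom*oddPoch : ∀ m → oddGeom m * oddPoch (suc m) ≈ 1# - qS
oddGeom*oddPoch zero = solve 1 (λ q → con 1ℤ :* (con 1ℤ :* (con 1ℤ :- q :^ 1)) := con 1ℤ :- q) ≈-refl qS
oddGeom*oddPoch (suc m) = begin
  oddGeom m * g * (oddPoch (suc m) * (1# - q^ (suc (2 ℕ.* suc m))))
    ≈⟨ solve 4 (λ a g b c → a :* g :* (b :* c) := (a :* b) :* (g :* c)) ≈-refl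
         (oddGeom m) g (oddPoch (suc m)) (1# - q^ (suc (2 ℕ.* suc m))) ⟩
  (oddGeom m * oddPoch (suc m)) * (g * (1# - q^ (suc (2 ℕ.* suc m))))
    ≈⟨ *-cong (oddGeom*oddPoch m) (geom-inverse (suc (2 ℕ.* suc m))) ⟩
  (1# - qS) * 1#
    ≈⟨ solve 1 (λ q → (con 1ℤ :- q) :* con 1ℤ := con 1ℤ :- q) ≈-refl qS ⟩
  1# - qS ∎
  where
  open ≈-Reasoning
  g = geom (suc (2 ℕ.* suc m))

qPoch-suc : ∀ a r n → qPoch a r (suc n) ≈ qPoch a r n * (1# - a * r ^ n)
qPoch-suc a r n = ≈-trans (mulS≈* (qPoch a r n) (subS oneS (mulS a (powS r n))))
  (*-congˡ (+-cong oneS≈1 (-‿cong (≈-trans (mulS≈* a (powS r n)) (*-congˡ (powS≈^ r n))))))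

qPoch-evenPoch : ∀ m → qPoch (negS (powS qS 2)) (powS qS 2) m ≈ evenPoch m
qPoch-evenPoch zero    = oneS≈1
qPoch-evenPoch (suc m) = ≈-trans (qPoch-suc (negS (powS qS 2)) (powS qS 2) m) (*-cong (qPoch-evenPoch m) (begin
  1# - (- powS qS 2 * powS qS 2 ^ m)
    ≈⟨ +-congˡ {1#} (-‿cong (*-cong (-‿cong q²≈) [q²]^m≈)) ⟩
  1# - (- q^ 2 * q^ (2 ℕ.* m))
    ≈⟨ solve 2 (λ a b → con 1ℤ :- (:- a :* b) := con 1ℤ :+ a :* b) ≈-refl (q^ 2) (q^ (2 ℕ.* m)) ⟩
  1# + q^ 2 * q^ (2 ℕ.* m)
    ≈⟨ +-congˡ {1#} (^-homo-* qS 2 (2 ℕ.* m)) ⟨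
  1# + q^ (2 ℕ.+ 2 ℕ.* m)
    ≡⟨ cong (λ k → 1# + q^ k) (ℕ.*-suc 2 m) ⟨
  1# + q^ (2 ℕ.* suc m) ∎))
  where
  open ≈-Reasoning
  q²≈ : powS qS 2 ≈ q^ 2
  q²≈ = powS≈^ qS 2
  [q²]^m≈ : powS qS 2 ^ m ≈ q^ (2 ℕ.* m)
  [q²]^m≈ = ≈-trans (^-cong q²≈ (refl {x = m})) (^-assocʳ qS 2 m)

[-q]^2n : ∀ n → (- qS) ^ (2 ℕ.* n) ≈ q^ (2 ℕ.* n)
[-q]^2n n = begin
  (- qS) ^ (2 ℕ.* n)  ≈⟨ ^-assocʳ (- qS) 2 n ⟨
  ((- qS) ^ 2) ^ n    ≈⟨ ^-cong (solve 1 (λ q → (:- q) :^ 2 := q :^ 2) ≈-refl qS) (refl {x = n}) ⟩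
  (q^ 2) ^ n          ≈⟨ ^-assocʳ qS 2 n ⟩
  q^ (2 ℕ.* n)        ∎
  where open ≈-Reasoning

qPoch-oddPoch*evenPoch : ∀ n → qPoch qS (negS qS) (2 ℕ.* n) ≈ oddPoch n * evenPoch n
qPoch-oddPoch*evenPoch zero = ≈-trans oneS≈1 (solve 0 (con 1ℤ := con 1ℤ :* con 1ℤ) ≈-refl)
qPoch-oddPoch*evenPoch (suc n) = begin
  qPoch qS (negS qS) (2 ℕ.* suc n)            ≡⟨ cong (qPoch qS (negS qS)) (ℕ.*-suc 2 n) ⟩
  qPoch qS (negS qS) (suc (suc (2 ℕ.* n)))
    ≈⟨ ≈-trans (qPoch-suc qS (negS qS) (suc (2 ℕ.* n))) (*-congʳ (qPoch-suc qS (negS qS) (2 ℕ.* n))) ⟩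
  qPoch qS (negS qS) (2 ℕ.* n) * evenFactor * oddFactor
    ≈⟨ *-cong (*-cong (qPoch-oddPoch*evenPoch n) evenFactor≈) oddFactor≈ ⟩
  oddPoch n * evenPoch n * (1# - q^ (suc (2 ℕ.* n))) * (1# + q^ (2 ℕ.* suc n))
    ≈⟨ solve 4 (λ o p a b → o :* p :* a :* b := (o :* a) :* (p :* b)) ≈-refl
         (oddPoch n) (evenPoch n) (1# - q^ (suc (2 ℕ.* n))) (1# + q^ (2 ℕ.* suc n)) ⟩
  oddPoch (suc n) * evenPoch (suc n) ∎
  where
  open ≈-Reasoning
  evenFactor = 1# - qS * (- qS) ^ (2 ℕ.* n)
  oddFactor  = 1# - qS * (- qS) ^ suc (2 ℕ.* n)
  evenFactor≈ : evenFactor ≈ 1# - q^ (suc (2 ℕ.* n))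
  evenFactor≈ = +-congˡ {1#} (-‿cong (*-congˡ {qS} ([-q]^2n n)))
  oddFactor≈ : oddFactor ≈ 1# + q^ (2 ℕ.* suc n)
  oddFactor≈ = begin
    1# - qS * ((- qS) * (- qS) ^ (2 ℕ.* n))
      ≈⟨ +-congˡ {1#} (-‿cong (*-congˡ {qS} (*-congˡ { - qS} ([-q]^2n n)))) ⟩
    1# - qS * ((- qS) * q^ (2 ℕ.* n))
      ≈⟨ solve 2 (λ q a → con 1ℤ :- q :* ((:- q) :* a) := con 1ℤ :+ q :* (q :* a)) ≈-refl
           qS (q^ (2 ℕ.* n)) ⟩
    1# + q^ (2 ℕ.+ 2 ℕ.* n)                   ≡⟨ cong (λ k → 1# + q^ k) (ℕ.*-suc 2 n) ⟨
    1# + q^ (2 ℕ.* suc n)                     ∎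

qPoch-q-constant : ∀ a n → qPoch qS a n 0 ≡ 1ℤ
qPoch-q-constant a zero    = refl
qPoch-q-constant a (suc n) = trans (mulS-zero (qPoch qS a n) (subS oneS (mulS qS (powS a n))))
  (cong₂ (λ c d → c ℤ.* (1ℤ ℤ.- d) ℤ.+ 0ℤ) (qPoch-q-constant a n)
         (trans (mulS-zero qS (powS a n)) (ℤP.*-zeroˡ (powS a n 0))))

summand≈ : ∀ n → summand n ≈
  qPoch (negS (powS qS 2)) (powS qS 2) (n ∸ 1) ^ 2 * q^ (2 ℕ.* n) * invS (qPoch qS (negS qS) (2 ℕ.* n))
summand≈ n = ≈-trans (mulS≈* (mulS (powS P 2) (powS qS (2 ℕ.* n))) I)
  (*-congʳ (≈-trans (mulS≈* (powS P 2) (powS qS (2 ℕ.* n))) (*-cong (powS≈^ P 2) (powS≈^ qS (2 ℕ.* n)))))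
  where
  P = qPoch (negS (powS qS 2)) (powS qS 2) (n ∸ 1)
  I = invS (qPoch qS (negS qS) (2 ℕ.* n))

summand-divisible : ∀ n → ∃[ g ] summand n ≈ q^ (2 ℕ.* n) * g
summand-divisible n = A * I , ≈-trans (summand≈ n)
  (≈-trans (*-congʳ (*-comm A (q^ (2 ℕ.* n)))) (*-assoc (q^ (2 ℕ.* n)) A I))
  where
  A = qPoch (negS (powS qS 2)) (powS qS 2) (n ∸ 1) ^ 2
  I = invS (qPoch qS (negS qS) (2 ℕ.* n))

summand-coeff-< : ∀ n N → N < 2 ℕ.* n → summand n N ≡ 0ℤ
summand-coeff-< n N N<2n =
  trans (coeff (proj₂ (summand-divisible n)) N) (q^*-coeff-< (2 ℕ.* n) (proj₁ (summand-divisible n)) N N<2n)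

term : ℕ → Series
term m = evenPoch m * q^ e * ((1# - q^ e) * geom (e ℕ.+ e) * oddGeom m)
  where e = 2 ℕ.* suc m

[1-q]*summand≈term : ∀ m → (1# - qS) * summand (suc m) ≈ term m
[1-q]*summand≈term m = *-cancelʳ-invertible D I D*I≈1 (begin
  (1# - qS) * summand (suc m) * D
    ≈⟨ *-congʳ (*-congˡ (summand≈ (suc m))) ⟩
  (1# - qS) * (P ^ 2 * q^ e * I) * D
    ≈⟨ solve 5 (λ a p x i d → (a :* (p :* x :* i)) :* d := a :* p :* x :* (d :* i)) ≈-refl
         (1# - qS) (P ^ 2) (q^ e) I D ⟩
  (1# - qS) * P ^ 2 * q^ e * (D * I)
    ≈⟨ *-cong (*-congʳ (*-congˡ (^-cong (qPoch-evenPoch m) (refl {x = 2})))) D*I≈1 ⟩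
  (1# - qS) * (E * (E * 1#)) * q^ e * 1#
    ≈⟨ solve 3 (λ a p x → a :* (p :* (p :* con 1ℤ)) :* x :* con 1ℤ := p :* x :* p :* con 1ℤ :* a)
         ≈-refl (1# - qS) E (q^ e) ⟩
  E * q^ e * E * 1# * (1# - qS)
    ≈⟨ *-cong (*-congˡ ([1-q^e]*[1+q^e]*geom[e+e] e)) (oddGeom*oddPoch m) ⟨
  E * q^ e * E * ((1# - q^ e) * (1# + q^ e) * geom (e ℕ.+ e)) * (oddGeom m * oddPoch (suc m))
    ≈⟨ solve 7 (λ p x b c g o r → p :* x :* p :* (b :* c :* g) :* (o :* r)
                   := p :* x :* (b :* g :* o) :* (r :* (p :* c))) ≈-refl
         E (q^ e) (1# - q^ e) (1# + q^ e) (geom (e ℕ.+ e)) (oddGeom m) (oddPoch (suc m)) ⟩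
  term m * (oddPoch (suc m) * evenPoch (suc m))
    ≈⟨ *-congˡ (qPoch-oddPoch*evenPoch (suc m)) ⟨
  term m * D ∎)
  where
  open ≈-Reasoning
  e = 2 ℕ.* suc m
  D = qPoch qS (negS qS) e
  I = invS D
  D*I≈1 = *-invS D (qPoch-q-constant (negS qS) e)
  P = qPoch (negS (powS qS 2)) (powS qS 2) m
  E = evenPoch m

-- The terms with m ≥ 3

nonneg-evenPoch : ∀ m → Nonneg (evenPoch m)
nonneg-evenPoch zero    = nonneg-constS 1
nonneg-evenPoch (suc m) = nonneg-* (nonneg-evenPoch m) (nonneg-+ (nonneg-constS 1) (nonneg-q^ (2 ℕ.* suc m)))

oddGeom≈geom3* : ∀ k → ∃[ r ] Nonneg r × oddGeom (suc k) ≈ geom 3 * r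
oddGeom≈geom3* zero    = 1# , nonneg-constS 1 , *-comm 1# (geom 3)
oddGeom≈geom3* (suc k) with oddGeom≈geom3* k
... | r , r≥0 , oddGeom≈ = r * g , nonneg-* r≥0 (nonneg-geom _) ,
  ≈-trans (*-congʳ oddGeom≈) (*-assoc (geom 3) r g)
  where g = geom (suc (2 ℕ.* suc (suc k)))

nonneg-term : ∀ k → Nonneg (term (3 ℕ.+ k))
nonneg-term k with oddGeom≈geom3* k
... | r , r≥0 , oddGeom≈ = nonneg-cong (≈-sym term≈)
  (nonneg-* (nonneg-* (nonneg-* (nonneg-* (nonneg-* (nonneg-evenPoch m) (nonneg-q^ e)) (nonneg-geom (e ℕ.+ e))) r≥0)
                      (nonneg-geom b′))
            (nonneg-+ (nonneg-geom b) (nonneg-* (nonneg-q^ 3) (nonneg-geom 3))))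
  where
  m = 3 ℕ.+ k
  e = 2 ℕ.* suc m
  b = suc (2 ℕ.* suc (suc k))
  b′ = suc (2 ℕ.* m)
  term≈ : term m ≈ evenPoch m * q^ e * geom (e ℕ.+ e) * r * geom b′ * (geom b + q^ 3 * geom 3)
  term≈ = begin
    E * q^ e * ((1# - q^ e) * geom (e ℕ.+ e) * (oddGeom (suc k) * geom b * geom b′))
      ≈⟨ *-congˡ {E * q^ e} (*-cong (*-congʳ {geom (e ℕ.+ e)} (+-congˡ {1#} (-‿cong (q^-cong e≡3+b))))
                                   (*-congʳ (*-congʳ oddGeom≈))) ⟩
    E * q^ e * ((1# - q^ (3 ℕ.+ b)) * geom (e ℕ.+ e) * (geom 3 * r * geom b * geom b′))
      ≈⟨ solve 8 (λ p x a g g₃ r g₁ g₂ → p :* x :* (a :* g :* (g₃ :* r :* g₁ :* g₂))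
                    := p :* x :* g :* r :* g₂ :* (a :* g₃ :* g₁)) ≈-refl
           E (q^ e) (1# - q^ (3 ℕ.+ b)) (geom (e ℕ.+ e)) (geom 3) r (geom b) (geom b′) ⟩
    E * q^ e * geom (e ℕ.+ e) * r * geom b′ * ((1# - q^ (3 ℕ.+ b)) * geom 3 * geom b)
      ≈⟨ *-congˡ ([1-q^a+b]*geom*geom 3 b) ⟩
    E * q^ e * geom (e ℕ.+ e) * r * geom b′ * (geom b + q^ 3 * geom 3) ∎
    where
    open ≈-Reasoning
    E = evenPoch m
    e≡3+b : e ≡ 3 ℕ.+ b
    e≡3+b = cong (3 ℕ.+_) (cong suc (trans (ℕ.+-suc k _) (cong suc (ℕ.+-suc k _))))

-- The terms with m < 3

-- c₄ = (1-q²⁴)/(1-q⁴),  b₅ = (1-q²⁵)/(1-q⁵),  m₂ = (1-q⁴)(1-q²⁴)/((1-q³)(1-q⁸))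
c₄ b₅ m₂ : Polynomial 1
c₄ = con 1ℤ :+ X :^ 4 :+ X :^ 8 :+ X :^ 12 :+ X :^ 16 :+ X :^ 20
b₅ = con 1ℤ :+ X :^ 5 :+ X :^ 10 :+ X :^ 15 :+ X :^ 20
m₂ = con 1ℤ :+ X :^ 3 :- X :^ 4 :+ X :^ 6 :- X :^ 7 :+ X :^ 8 :+ X :^ 9 :- X :^ 10 :+ X :^ 11 :- X :^ 13
     :+ X :^ 14 :+ X :^ 17

geom4≈c₄*geom24 : geom 4 ≈ ⟦ c₄ ⟧q * geom 24
geom4≈c₄*geom24 = geom≈*geom 4 24 ⟦ c₄ ⟧q
  (from-just (q-identity? (con 1ℤ :- X :^ 24) ((con 1ℤ :- X :^ 4) :* c₄)))

geom12≈[1+q¹²]*geom24 : geom 12 ≈ (1# + q^ 12) * geom 24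
geom12≈[1+q¹²]*geom24 = geom≈*geom 12 24 (1# + q^ 12)
  (from-just (q-identity? (con 1ℤ :- X :^ 24) ((con 1ℤ :- X :^ 12) :* (con 1ℤ :+ X :^ 12))))

[1-q⁴]*geom8*geom3≈m₂*geom24 : (1# - q^ 4) * geom 8 * geom 3 ≈ ⟦ m₂ ⟧q * geom 24
[1-q⁴]*geom8*geom3≈m₂*geom24 = [1-q^a]*geom*geom≈*geom 4 8 3 24 ⟦ m₂ ⟧q
  (from-just (q-identity? ((con 1ℤ :- X :^ 4) :* (con 1ℤ :- X :^ 24))
                          ((con 1ℤ :- X :^ 8) :* (con 1ℤ :- X :^ 3) :* m₂)))

geom5≈b₅+q²⁵*geom5 : geom 5 ≈ ⟦ b₅ ⟧q + q^ 25 * geom 5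
geom5≈b₅+q²⁵*geom5 = geom≈+q^*geom 5 25 ⟦ b₅ ⟧q
  (from-just (q-identity? (b₅ :* (con 1ℤ :- X :^ 5)) (con 1ℤ :- X :^ 25)))

a₃ : Polynomial 1
a₃ = con 1ℤ :* (con 1ℤ :+ X :^ 2) :* (con 1ℤ :+ X :^ 4) :* X :^ 6 :* (con 1ℤ :+ X :^ 3)

term0≈ : term 0 ≈ q^ 2 * (1# - q^ 2) * ⟦ c₄ ⟧q * geom 24
term0≈ = begin
  1# * q^ 2 * ((1# - q^ 2) * geom 4 * 1#)
    ≈⟨ *-congˡ (*-congʳ (*-congˡ geom4≈c₄*geom24)) ⟩
  1# * q^ 2 * ((1# - q^ 2) * (⟦ c₄ ⟧q * geom 24) * 1#)
    ≈⟨ solve 4 (λ y a c g → con 1ℤ :* y :* (a :* (c :* g) :* con 1ℤ) := y :* a :* c :* g) ≈-refl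
         (q^ 2) (1# - q^ 2) ⟦ c₄ ⟧q (geom 24) ⟩
  q^ 2 * (1# - q^ 2) * ⟦ c₄ ⟧q * geom 24 ∎
  where open ≈-Reasoning

term1≈ : term 1 ≈ (1# + q^ 2) * q^ 4 * ⟦ m₂ ⟧q * geom 24
term1≈ = begin
  1# * (1# + q^ 2) * q^ 4 * ((1# - q^ 4) * geom 8 * (1# * geom 3))
    ≈⟨ solve 5 (λ p y a g₈ g₃ → con 1ℤ :* p :* y :* (a :* g₈ :* (con 1ℤ :* g₃))
                                := p :* y :* (a :* g₈ :* g₃)) ≈-refl
         (1# + q^ 2) (q^ 4) (1# - q^ 4) (geom 8) (geom 3) ⟩
  (1# + q^ 2) * q^ 4 * ((1# - q^ 4) * geom 8 * geom 3)
    ≈⟨ *-congˡ [1-q⁴]*geom8*geom3≈m₂*geom24 ⟩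
  (1# + q^ 2) * q^ 4 * (⟦ m₂ ⟧q * geom 24)
    ≈⟨ *-assoc ((1# + q^ 2) * q^ 4) ⟦ m₂ ⟧q (geom 24) ⟨
  (1# + q^ 2) * q^ 4 * ⟦ m₂ ⟧q * geom 24 ∎
  where open ≈-Reasoning

term2≈ : term 2 ≈
  ⟦ a₃ ⟧q * ⟦ b₅ ⟧q * (1# + q^ 12) * geom 24 + ⟦ a₃ ⟧q * q^ 25 * geom 5 * (1# + q^ 12) * geom 24
term2≈ = begin
  P * q^ 6 * ((1# - q^ 6) * geom 12 * (1# * geom 3 * geom 5))
    ≈⟨ *-congˡ (*-congʳ (*-congʳ 1-q⁶≈)) ⟩
  P * q^ 6 * ((1# + q^ 3) * (1# - q^ 3) * geom 12 * (1# * geom 3 * geom 5))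
    ≈⟨ solve 7 (λ p y a b g₁₂ g₃ g₅ → p :* y :* (a :* b :* g₁₂ :* (con 1ℤ :* g₃ :* g₅))
                  := p :* y :* a :* (g₃ :* b) :* g₅ :* g₁₂) ≈-refl
         P (q^ 6) (1# + q^ 3) (1# - q^ 3) (geom 12) (geom 3) (geom 5) ⟩
  P * q^ 6 * (1# + q^ 3) * (geom 3 * (1# - q^ 3)) * geom 5 * geom 12
    ≈⟨ *-cong (*-cong (*-congˡ (geom-inverse 3)) geom5≈b₅+q²⁵*geom5) geom12≈[1+q¹²]*geom24 ⟩
  P * q^ 6 * (1# + q^ 3) * 1# * (⟦ b₅ ⟧q + q^ 25 * geom 5) * ((1# + q^ 12) * geom 24)
    ≈⟨ solve 8 (λ p y a b z g₅ c g → p :* y :* a :* con 1ℤ :* (b :+ z :* g₅) :* (c :* g)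
                  := p :* y :* a :* b :* c :* g :+ p :* y :* a :* z :* g₅ :* c :* g) ≈-refl
         P (q^ 6) (1# + q^ 3) ⟦ b₅ ⟧q (q^ 25) (geom 5) (1# + q^ 12) (geom 24) ⟩
  ⟦ a₃ ⟧q * ⟦ b₅ ⟧q * (1# + q^ 12) * geom 24 + ⟦ a₃ ⟧q * q^ 25 * geom 5 * (1# + q^ 12) * geom 24 ∎
  where
  open ≈-Reasoning
  P = evenPoch 2
  1-q⁶≈ : 1# - q^ 6 ≈ (1# + q^ 3) * (1# - q^ 3)
  1-q⁶≈ = from-just (q-identity? (con 1ℤ :- X :^ 6) ((con 1ℤ :+ X :^ 3) :* (con 1ℤ :- X :^ 3)))

onePlusNonneg-evenPoch : ∀ m → OnePlusNonneg (evenPoch m)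
onePlusNonneg-evenPoch zero    = onePlusNonneg-1#
onePlusNonneg-evenPoch (suc m) =
  onePlusNonneg-* (onePlusNonneg-evenPoch m) (onePlusNonneg-1+ (nonneg-q^ (2 ℕ.* suc m)))

term3≈ : term 3 ≈ q^ 8 * (evenPoch 3 * geom 16 * geom 7 * (geom 5 + q^ 3 * geom 3))
term3≈ = begin
  P * q^ 8 * ((1# - q^ 8) * geom 16 * (1# * geom 3 * geom 5 * geom 7))
    ≈⟨ solve 7 (λ p y a g₁₆ g₃ g₅ g₇ → p :* y :* (a :* g₁₆ :* (con 1ℤ :* g₃ :* g₅ :* g₇))
                  := y :* (p :* g₁₆ :* g₇ :* (a :* g₃ :* g₅))) ≈-refl
         P (q^ 8) (1# - q^ 8) (geom 16) (geom 3) (geom 5) (geom 7) ⟩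
  q^ 8 * (P * geom 16 * geom 7 * ((1# - q^ (3 ℕ.+ 5)) * geom 3 * geom 5))
    ≈⟨ *-congˡ (*-congˡ ([1-q^a+b]*geom*geom 3 5)) ⟩
  q^ 8 * (P * geom 16 * geom 7 * (geom 5 + q^ 3 * geom 3)) ∎
  where
  open ≈-Reasoning
  P = evenPoch 3

onePlusNonneg-term3 : OnePlusNonneg (evenPoch 3 * geom 16 * geom 7 * (geom 5 + q^ 3 * geom 3))
onePlusNonneg-term3 =
  onePlusNonneg-* (onePlusNonneg-* (onePlusNonneg-* (onePlusNonneg-evenPoch 3) (onePlusNonneg-geom 16))
                                   (onePlusNonneg-geom 7))
    (onePlusNonneg-cong (≈-sym geom5+q³geom3≈) (onePlusNonneg-1+ (nonneg-+ (nonneg-* (nonneg-q^ 5) (nonneg-geom 5))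
                                                                       (nonneg-* (nonneg-q^ 3) (nonneg-geom 3)))))
  where
  geom5+q³geom3≈ : geom 5 + q^ 3 * geom 3 ≈ 1# + (q^ 5 * geom 5 + q^ 3 * geom 3)
  geom5+q³geom3≈ = ≈-trans (+-congʳ (geom-unfold 5)) (+-assoc 1# (q^ 5 * geom 5) (q^ 3 * geom 3))

leading : Polynomial 1
leading = X :^ 2 :* (con 1ℤ :- X :^ 2) :* c₄ :+ (con 1ℤ :+ X :^ 2) :* X :^ 4 :* m₂
          :+ a₃ :* b₅ :* (con 1ℤ :+ X :^ 12) :+ X :^ 8 :* (con 1ℤ :- X :^ 24)

leadingCoefficients : List ℕ
leadingCoefficients =
  0 ∷ 0 ∷ 1 ∷ 0 ∷ 0 ∷ 0 ∷ 3 ∷ 1 ∷ 0 ∷ 2 ∷ 2 ∷ 1 ∷ 2 ∷ 2 ∷ 2 ∷ 4 ∷ 0 ∷ 1 ∷ 5 ∷ 0 ∷ 3 ∷ 4 ∷ 3 ∷ 5 ∷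
  1 ∷ 4 ∷ 3 ∷ 3 ∷ 4 ∷ 2 ∷ 4 ∷ 2 ∷ 2 ∷ 3 ∷ 1 ∷ 3 ∷ 1 ∷ 2 ∷ 2 ∷ 1 ∷ 2 ∷ 1 ∷ 2 ∷ 1 ∷ 1 ∷ 1 ∷ 0 ∷ 1 ∷ []

leading≈polynomial : ⟦ leading ⟧q ≈ polynomial leadingCoefficients
leading≈polynomial = from-just (q-identity? leading (horner leadingCoefficients))

first-four-terms : ∃[ r ] Nonneg r × ∑S 4 term ≈ ⟦ leading ⟧q * geom 24 + r
first-four-terms = split onePlusNonneg-term3
  where
  open ≈-Reasoning
  g = geom 24
  A = q^ 2 * (1# - q^ 2) * ⟦ c₄ ⟧q
  B = (1# + q^ 2) * q^ 4 * ⟦ m₂ ⟧q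
  C = ⟦ a₃ ⟧q * ⟦ b₅ ⟧q * (1# + q^ 12)
  R = ⟦ a₃ ⟧q * q^ 25 * geom 5 * (1# + q^ 12) * geom 24
  R≥0 : Nonneg R
  R≥0 = nonneg-* (nonneg-* (nonneg-* (nonneg-* a₃≥0 (nonneg-q^ 25)) (nonneg-geom 5))
                           (nonneg-+ (nonneg-constS 1) (nonneg-q^ 12)))
                 (nonneg-geom 24)
    where
    a₃≥0 : Nonneg ⟦ a₃ ⟧q
    a₃≥0 = nonneg-* (nonneg-* (nonneg-evenPoch 2) (nonneg-q^ 6)) (nonneg-+ (nonneg-constS 1) (nonneg-q^ 3))
  split : OnePlusNonneg (evenPoch 3 * geom 16 * geom 7 * (geom 5 + q^ 3 * geom 3)) →
          ∃[ r ] Nonneg r × ∑S 4 term ≈ ⟦ leading ⟧q * geom 24 + r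
  split (h , h≥0 , Q≈1+h) = R + q^ 8 * h , nonneg-+ R≥0 (nonneg-* (nonneg-q^ 8) h≥0) , (begin
    0# + term 0 + term 1 + term 2 + term 3
      ≈⟨ +-cong (+-cong (+-cong (≈-trans (+-identityˡ (term 0)) term0≈) term1≈) term2≈)
                (≈-trans term3≈ (*-congˡ Q≈1+h)) ⟩
    A * g + B * g + (C * g + R) + q^ 8 * (1# + h)
      ≈⟨ +-congˡ {A * g + B * g + (C * g + R)} (*-congˡ {q^ 8} (+-congʳ {h} (geom-inverse 24))) ⟨
    A * g + B * g + (C * g + R) + q^ 8 * (g * (1# - q^ 24) + h)
      ≈⟨ solve 8 (λ a b c g r y d h → a :* g :+ b :* g :+ (c :* g :+ r) :+ y :* (g :* d :+ h)
                    := (a :+ b :+ c :+ y :* d) :* g :+ (r :+ y :* h)) ≈-refl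
           A B C g R (q^ 8) (1# - q^ 24) h ⟩
    ⟦ leading ⟧q * g + (R + q^ 8 * h) ∎)

-- Telescoping

nonneg-∑S-term : ∀ k → Nonneg (∑S (4 ℕ.+ k) term)
nonneg-∑S-term zero    = nonneg-cong (≈-sym (proj₂ (proj₂ first-four-terms)))
  (nonneg-+ (nonneg-* (nonneg-cong (≈-sym leading≈polynomial) (nonneg-polynomial leadingCoefficients))
                      (nonneg-geom 24))
            (proj₁ (proj₂ first-four-terms)))
nonneg-∑S-term (suc k) = nonneg-+ (nonneg-∑S-term k) (nonneg-term (suc k))

u2bar≡∑S-summand : ∀ j N → u2bar N ≡ ∑S (j ℕ.+ N) (summand ∘ suc) N
u2bar≡∑S-summand zero    N =
  trans (sumBelow≡∑ N (λ k → summand (suc k) N)) (sym (∑S-coeff N (summand ∘ suc) N))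
u2bar≡∑S-summand (suc j) N = begin
  u2bar N                                                         ≡⟨ u2bar≡∑S-summand j N ⟩
  ∑S (j ℕ.+ N) (summand ∘ suc) N                                  ≡⟨ ℤP.+-identityʳ _ ⟨
  ∑S (j ℕ.+ N) (summand ∘ suc) N ℤ.+ 0ℤ
    ≡⟨ cong (ℤ._+_ (∑S (j ℕ.+ N) (summand ∘ suc) N)) (summand-coeff-< (suc (j ℕ.+ N)) N N<2[1+j+N]) ⟨
  ∑S (suc j ℕ.+ N) (summand ∘ suc) N                              ∎
  where
  open ≡-Reasoning
  N<2[1+j+N] : N < 2 ℕ.* suc (j ℕ.+ N)
  N<2[1+j+N] = ℕ.<-≤-trans (s≤s (ℕ.m≤n+m N j)) (ℕ.m≤n*m (suc (j ℕ.+ N)) 2)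

u2bar-difference : ∀ N → ∑S (5 ℕ.+ N) term (suc N) ≡ u2bar (suc N) ℤ.- u2bar N
u2bar-difference N = begin
  ∑S (5 ℕ.+ N) term (suc N)                                 ≡⟨ coeff [1-q]*∑S≈∑S-term (suc N) ⟨
  ((1# - qS) * ∑S (5 ℕ.+ N) (summand ∘ suc)) (suc N)
    ≡⟨ [1-q]*-coeff-suc (∑S (5 ℕ.+ N) (summand ∘ suc)) N ⟩
  ∑S (5 ℕ.+ N) (summand ∘ suc) (suc N) ℤ.- ∑S (5 ℕ.+ N) (summand ∘ suc) N
    ≡⟨ cong₂ ℤ._-_ (u2bar≡∑S-summand 4 (suc N)) (u2bar≡∑S-summand 5 N) ⟨
  u2bar (suc N) ℤ.- u2bar N                                 ∎
  where
  open ≡-Reasoning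
  [1-q]*∑S≈∑S-term : (1# - qS) * ∑S (5 ℕ.+ N) (summand ∘ suc) ≈ ∑S (5 ℕ.+ N) term
  [1-q]*∑S≈∑S-term =
    ≈-trans (*-distribˡ-∑S (1# - qS) (5 ℕ.+ N) (summand ∘ suc)) (∑S-cong (5 ℕ.+ N) [1-q]*summand≈term)

lemma4p3 : (n : ℕ) → u2bar n ≤ u2bar (suc n)
lemma4p3 n =
  ℤP.0≤i-j⇒j≤i (subst (0ℤ ≤_) (u2bar-difference n) (coeff-nonneg (nonneg-∑S-term (suc n)) (suc n)))
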